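{- If $2\ell^2>n(n-1)$, then $\mu(\ell,n)\le1$.
   Context: An $\ell$-cycle system of order $n$ is a set of $\ell$-cycles whose edge sets partition the edge set of $K_n$. Two such systems $\mathcal F,\mathcal F'$ are orthogonal if every $C\in\mathcal F$ and $C'\in\mathcal F'$ share at most one edge; mutually orthogonal means pairwise orthogonal. $\mu(\ell,n)$ is the maximum size of a set of mutually orthogonal $\ell$-cycle systems of order $n$. -}

module Defs where

open import Data.Nat using (ℕ; zero; suc; _≤_)
open import Data.Fin using (Fin; toℕ)
open import Data.List using (List)
open import Data.List.Membership.Propositional using (_∈_)
open import Data.Product using (Σ; ∃; ∃-syntax; _×_; _,_)
open import Data.Sum using (_⊎_)
open import Function.Definitions using (Injective)
open import Function.Bundles using (_⇔_)
open import Relation.Binary.PropositionalEquality using (_≡_)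
open import Relation.Nullary using (¬_)

-- Vertices of K_n are Fin n.  An ℓ-cycle (ℓ ≥ 3) in K_n is given by a
-- cyclic sequence of ℓ pairwise distinct vertices v₀ v₁ … v_{ℓ-1}; its
-- edges are {vᵢ, vᵢ₊₁} (indices mod ℓ).  A cycle is identified with its
-- edge set (see SameCycle).
record Cycle (ℓ n : ℕ) : Set where
  field
    three≤ℓ  : 3 ≤ ℓ
    vertex   : Fin ℓ → Fin n
    distinct : Injective _≡_ _≡_ vertex

Next : {ℓ : ℕ} → Fin ℓ → Fin ℓ → Set
Next {ℓ} i j = (suc (toℕ i) ≡ toℕ j) ⊎ (suc (toℕ i) ≡ ℓ × toℕ j ≡ 0)

HasEdge : {ℓ n : ℕ} → Cycle ℓ n → Fin n → Fin n → Set
HasEdge C a b =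
  ∃[ i ] ∃[ j ] (Next i j ×
    ((vertex i ≡ a × vertex j ≡ b) ⊎ (vertex i ≡ b × vertex j ≡ a)))
  where open Cycle C

SameEdge : {n : ℕ} → Fin n → Fin n → Fin n → Fin n → Set
SameEdge a b c d = (a ≡ c × b ≡ d) ⊎ (a ≡ d × b ≡ c)

SameCycle : {ℓ n : ℕ} → Cycle ℓ n → Cycle ℓ n → Set
SameCycle C D = ∀ a b → HasEdge C a b ⇔ HasEdge D a b

-- An ℓ-cycle system of order n: a finite family of ℓ-cycles such that every
-- edge {a,b} (a ≠ b) of K_n lies in exactly one member of the family
-- (exactly one position of the list; so no cycle is repeated).
IsCycleSystem : (ℓ n : ℕ) → List (Cycle ℓ n) → Set
IsCycleSystem ℓ n F =
  ∀ (a b : Fin n) → ¬ a ≡ b →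
    Σ (Σ (Cycle ℓ n) (λ C → C ∈ F)) (λ p → HasEdge (Data.Product.proj₁ p) a b ×
      ((q : Σ (Cycle ℓ n) (λ C → C ∈ F)) → HasEdge (Data.Product.proj₁ q) a b → q ≡ p))

Orthogonal : {ℓ n : ℕ} → List (Cycle ℓ n) → List (Cycle ℓ n) → Set
Orthogonal {ℓ} {n} F F' =
  ∀ (C C' : Cycle ℓ n) → C ∈ F → C' ∈ F' →
  ∀ (a b c d : Fin n) →
    HasEdge C a b → HasEdge C' a b → HasEdge C c d → HasEdge C' c d →
    SameEdge a b c d

SameSystem : {ℓ n : ℕ} → List (Cycle ℓ n) → List (Cycle ℓ n) → Set
SameSystem {ℓ} {n} F F' =
  (∀ C → C ∈ F → ∃[ D ] (D ∈ F' × SameCycle C D)) ×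
  (∀ D → D ∈ F' → ∃[ C ] (C ∈ F × SameCycle C D))

-- Let C be a cycle of F. Its ℓ edges lie in ℓ cycles D₀ … D_{ℓ-1} of F',
-- pairwise distinct because each Dᵢ meets C in at most one edge. Being
-- members of one cycle system, the Dᵢ are edge-disjoint, so their ℓ² edges,
-- i.e. 2ℓ² ordered pairs of distinct vertices, are all different; hence
-- 2ℓ² ≤ n(n-1). So under the hypothesis neither F nor F' has a cycle.
module Submission where

open import Defs
open import Data.Nat using (ℕ; _*_; _∸_; _<_)
open import Data.List using (List)

open import Data.Nat using (zero; suc; _≤_; _<?_; z≤n)
import Data.Nat.Properties as ℕ
open import Data.Fin using (Fin; zero; suc; toℕ; fromℕ<; punchOut; combine; remQuot)
import Data.Fin.Properties as Fin
open import Data.Product using (Σ; _×_; _,_; proj₁; proj₂; uncurry; map₂)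
open import Data.Product.Properties using (,-injectiveˡ; ,-injectiveʳ)
open import Data.Sum using (inj₁; inj₂)
open import Data.Empty using (⊥-elim)
open import Data.List.Membership.Propositional using (_∈_)
open import Function using (_∘_; Injective)
open import Function.Bundles using (Injection)
open import Function.Properties.Inverse using (↔⇒↣)
open import Relation.Nullary using (¬_; yes; no)
open import Relation.Binary.PropositionalEquality

remQuot-injective : ∀ {m} n → Injective _≡_ _≡_ (remQuot {m} n)
remQuot-injective n = Injection.injective (↔⇒↣ Fin.*↔×)

punchOut-injective′ : ∀ {m} {a b a′ b′ : Fin (suc m)} (a≢b : a ≢ b) (a′≢b′ : a′ ≢ b′) →
  a ≡ a′ → punchOut a≢b ≡ punchOut a′≢b′ → b ≡ b′
punchOut-injective′ a≢b a′≢b′ refl = Fin.punchOut-injective a≢b a′≢b′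

offDiagonal-injective⇒≤ : ∀ {k n} {f : Fin k → Fin n × Fin n} →
  Injective _≡_ _≡_ f → (∀ x → proj₁ (f x) ≢ proj₂ (f x)) → k ≤ n * (n ∸ 1)
offDiagonal-injective⇒≤ {zero} _ _ = z≤n
offDiagonal-injective⇒≤ {suc k} {zero} {f} _ _ with f zero
... | () , _
offDiagonal-injective⇒≤ {suc k} {suc m} {f} f-inj f-offDiag = Fin.injective⇒≤ g-inj
  where
  g : Fin (suc k) → Fin (suc m * m)
  g x = combine (proj₁ (f x)) (punchOut (f-offDiag x))

  g-inj : Injective _≡_ _≡_ g
  g-inj {x} {y} gx≡gy with Fin.combine-injective _ _ _ _ gx≡gy
  ... | a≡a′ , b̂≡b̂′ =
    f-inj (cong₂ _,_ a≡a′ (punchOut-injective′ (f-offDiag x) (f-offDiag y) a≡a′ b̂≡b̂′))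

next : ∀ {ℓ} → Fin ℓ → Fin ℓ
next {suc m} i with suc (toℕ i) <? suc m
... | yes 1+i<ℓ = fromℕ< 1+i<ℓ
... | no  _     = zero

Next-next : ∀ {ℓ} (i : Fin ℓ) → Next i (next i)
Next-next {suc m} i with suc (toℕ i) <? suc m
... | yes 1+i<ℓ = inj₁ (sym (Fin.toℕ-fromℕ< 1+i<ℓ))
... | no  1+i≮ℓ = inj₂ (ℕ.≤-antisym (Fin.toℕ<n i) (ℕ.≮⇒≥ 1+i≮ℓ) , refl)

module _ {ℓ : ℕ} where

  Next-irrefl : 2 ≤ ℓ → (i : Fin ℓ) → ¬ Next i i
  Next-irrefl _   i (inj₁ 1+i≡i)         = ℕ.1+n≢n 1+i≡i
  Next-irrefl 2≤ℓ i (inj₂ (1+i≡ℓ , i≡0)) = ℕ.<⇒≢ 2≤ℓ (trans (cong suc (sym i≡0)) 1+i≡ℓ)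

  Next-asym : 3 ≤ ℓ → (i j : Fin ℓ) → Next i j → ¬ Next j i
  Next-asym _ i j (inj₁ 1+i≡j) (inj₁ 1+j≡i) =
    ℕ.<-asym (ℕ.≤-reflexive 1+i≡j) (ℕ.≤-reflexive 1+j≡i)
  Next-asym 3≤ℓ i j (inj₁ 1+i≡j) (inj₂ (1+j≡ℓ , i≡0)) =
    ℕ.<⇒≢ 3≤ℓ (trans (cong (λ (m : ℕ) → suc (suc m)) (sym i≡0)) (trans (cong suc 1+i≡j) 1+j≡ℓ))
  Next-asym 3≤ℓ i j (inj₂ (1+i≡ℓ , j≡0)) (inj₁ 1+j≡i) =
    ℕ.<⇒≢ 3≤ℓ (trans (cong suc (trans (cong suc (sym j≡0)) 1+j≡i)) 1+i≡ℓ)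
  Next-asym 3≤ℓ i j (inj₂ (1+i≡ℓ , _)) (inj₂ (_ , i≡0)) =
    ℕ.<⇒≢ (ℕ.≤-trans (ℕ.n≤1+n 2) 3≤ℓ) (trans (cong suc (sym i≡0)) 1+i≡ℓ)

  next-irrefl : 2 ≤ ℓ → (i : Fin ℓ) → i ≢ next i
  next-irrefl 2≤ℓ i i≡next-i = Next-irrefl 2≤ℓ i (subst (Next i) (sym i≡next-i) (Next-next i))

  next-asym : 3 ≤ ℓ → (i j : Fin ℓ) → next i ≡ j → next j ≢ i
  next-asym 3≤ℓ i j next-i≡j next-j≡i =
    Next-asym 3≤ℓ i j (subst (Next i) next-i≡j (Next-next i)) (subst (Next j) next-j≡i (Next-next j))

module _ {ℓ n : ℕ} (E : Cycle ℓ n) where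
  open Cycle E

  arc : Fin 2 → Fin ℓ → Fin n × Fin n
  arc zero       k = vertex k , vertex (next k)
  arc (suc zero) k = vertex (next k) , vertex k

  HasEdge-arc : ∀ s k → uncurry (HasEdge E) (arc s k)
  HasEdge-arc zero       k = k , next k , Next-next k , inj₁ (refl , refl)
  HasEdge-arc (suc zero) k = k , next k , Next-next k , inj₂ (refl , refl)

  arc-offDiagonal : ∀ s k → proj₁ (arc s k) ≢ proj₂ (arc s k)
  arc-offDiagonal zero       k = next-irrefl 2≤ℓ k ∘ distinct
    where 2≤ℓ = ℕ.≤-trans (ℕ.n≤1+n 2) three≤ℓ
  arc-offDiagonal (suc zero) k = arc-offDiagonal zero k ∘ sym

  arc-injective : ∀ {s k s′ k′} → arc s k ≡ arc s′ k′ → s ≡ s′ × k ≡ k′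
  arc-injective {zero} {s′ = zero} eq = refl , distinct (,-injectiveˡ eq)
  arc-injective {suc zero} {s′ = suc zero} eq = refl , distinct (,-injectiveʳ eq)
  arc-injective {zero} {k} {suc zero} {k′} eq = ⊥-elim
    (next-asym three≤ℓ k k′ (distinct (,-injectiveʳ eq)) (sym (distinct (,-injectiveˡ eq))))
  arc-injective {suc zero} {k} {zero} {k′} eq = ⊥-elim
    (next-asym three≤ℓ k k′ (distinct (,-injectiveˡ eq)) (sym (distinct (,-injectiveʳ eq))))

  edge-injective : ∀ {i j} → SameEdge (vertex i) (vertex (next i)) (vertex j) (vertex (next j)) → i ≡ j
  edge-injective (inj₁ (vi≡vj , _)) = distinct vi≡vj
  edge-injective (inj₂ (vi≡vnj , vni≡vj)) with arc-injective {zero} {s′ = suc zero} (cong₂ _,_ vi≡vnj vni≡vj)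
  ... | () , _

Member : ∀ {ℓ n} → List (Cycle ℓ n) → Set
Member {ℓ} {n} F = Σ (Cycle ℓ n) (_∈ F)

module _ {ℓ n : ℕ} {F : List (Cycle ℓ n)} (sys : IsCycleSystem ℓ n F) where

  owner : ∀ {a b} → a ≢ b → Member F
  owner {a} {b} a≢b = proj₁ (sys a b a≢b)

  HasEdge-owner : ∀ {a b} (a≢b : a ≢ b) → HasEdge (proj₁ (owner a≢b)) a b
  HasEdge-owner {a} {b} a≢b = proj₁ (proj₂ (sys a b a≢b))

  owner-unique : ∀ {a b} → a ≢ b → (p q : Member F) →
    HasEdge (proj₁ p) a b → HasEdge (proj₁ q) a b → p ≡ q
  owner-unique {a} {b} a≢b p q p∋ab q∋ab =
    trans (unique p p∋ab) (sym (unique q q∋ab))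
    where unique = proj₂ (proj₂ (sys a b a≢b))

Orthogonal-sym : ∀ {ℓ n} {F F′ : List (Cycle ℓ n)} → Orthogonal F F′ → Orthogonal F′ F
Orthogonal-sym orth D C D∈ C∈ a b c d D∋ab C∋ab D∋cd C∋cd = orth C D C∈ D∈ a b c d C∋ab D∋ab C∋cd D∋cd

module _ {ℓ n : ℕ} {F F′ : List (Cycle ℓ n)} (sys′ : IsCycleSystem ℓ n F′)
         (orth : Orthogonal F F′) {C : Cycle ℓ n} (C∈F : C ∈ F) where

  through : Fin ℓ → Member F′
  through i = owner sys′ (arc-offDiagonal C zero i)

  through-injective : Injective _≡_ _≡_ through
  through-injective {i} {j} eq = edge-injective C
    (orth C (proj₁ (through i)) C∈F (proj₂ (through i)) _ _ _ _
      (HasEdge-arc C zero i) (HasEdge-owner sys′ _)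
      (HasEdge-arc C zero j) (subst (λ p → HasEdge (proj₁ p) _ _) (sym eq) (HasEdge-owner sys′ _)))

  arcs : Fin 2 × Fin ℓ × Fin ℓ → Fin n × Fin n
  arcs (s , i , k) = arc (proj₁ (through i)) s k

  arcs-offDiagonal : ∀ x → proj₁ (arcs x) ≢ proj₂ (arcs x)
  arcs-offDiagonal (s , i , k) = arc-offDiagonal (proj₁ (through i)) s k

  arcs-through : ∀ {s i k s′ i′ k′} → arcs (s , i , k) ≡ arcs (s′ , i′ , k′) → through i ≡ through i′
  arcs-through {s} {i} {k} {s′} {i′} {k′} eq =
    owner-unique sys′ (arcs-offDiagonal (s , i , k)) (through i) (through i′) (HasEdge-arc _ s k)
      (subst (uncurry (HasEdge (proj₁ (through i′)))) (sym eq) (HasEdge-arc _ s′ k′))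

  arcs-injective : Injective _≡_ _≡_ arcs
  arcs-injective {s , i , k} {s′ , i′ , k′} eq with through-injective (arcs-through eq)
  ... | refl with arc-injective (proj₁ (through i)) eq
  ... | refl , refl = refl

  orthogonal-cycle-bound : 2 * (ℓ * ℓ) ≤ n * (n ∸ 1)
  orthogonal-cycle-bound = offDiagonal-injective⇒≤ {f = arcs ∘ index}
    (index-injective ∘ arcs-injective) (arcs-offDiagonal ∘ index)
    where
    index : Fin (2 * (ℓ * ℓ)) → Fin 2 × Fin ℓ × Fin ℓ
    index = map₂ (remQuot ℓ) ∘ remQuot (ℓ * ℓ)

    index-injective : Injective _≡_ _≡_ index
    index-injective eq = remQuot-injective (ℓ * ℓ)
      (cong₂ _,_ (cong proj₁ eq) (remQuot-injective ℓ (cong proj₂ eq)))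

lemma21 : (ℓ n : ℕ) → n * (n ∸ 1) < 2 * (ℓ * ℓ) →
    (F F' : List (Cycle ℓ n)) → IsCycleSystem ℓ n F → IsCycleSystem ℓ n F' →
    Orthogonal F F' → SameSystem F F'
lemma21 ℓ n n[n-1]<2ℓ² F F′ sys sys′ orth =
  (λ C C∈F → ⊥-elim (ℕ.<⇒≱ n[n-1]<2ℓ² (orthogonal-cycle-bound sys′ orth C∈F))) ,
  (λ D D∈F′ → ⊥-elim (ℕ.<⇒≱ n[n-1]<2ℓ² (orthogonal-cycle-bound sys (Orthogonal-sym orth) D∈F′)))
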